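{- Let $G=(V_B\cup V_R,E)$ be a bipartite graph with blue vertices $V_B$ and red vertices $V_R$ such that no blue vertex $b$ satisfies $N(b)\subseteq N(b')$ for another blue vertex $b'$, and no red vertex $r$ satisfies $N(r)\supseteq N(r')$ for another red vertex $r'$. Let $k$ be an integer and let $v,w$ be two distinct blue vertices with $|P(v,w)|>1$ such that there is no blue vertex $d\neq v,w$ with $P(v,w)\subseteq N(d)$. Define $(G',k')$ as follows: (1) if $P(v,w)\not\subseteq N(v)$ and $P(v,w)\not\subseteq N(w)$: remove $v$, $w$ and $N(v,w)$ from $G$, and set $k'=k-2$; (2) if $P(v,w)\subseteq N(v)$ and $P(v,w)\subseteq N(w)$: remove $P(v,w)$ from $G$, add a new red vertex $r$ and the edges $\{v,r\},\{w,r\}$, and set $k'=k$; (3) if $P(v,w)\subseteq N(v)$ and $P(v,w)\not\subseteq N(w)$: remove $v$ and $N(v)$ from $G$, and set $k'=k-1$; (4) if $P(v,w)\not\subseteq N(v)$ and $P(v,w)\subseteq N(w)$: remove $w$ and $N(w)$ from $G$, and set $k'=k-1$. Then $G$ has a red-blue dominating set of size at most $k$ if and only if $G'$ has a red-blue dominating set of size at most $k'$.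
   Context: $N(v)=\{u:\{u,v\}\in E\}$, $N(S)=\bigcup_{s\in S}N(s)$, and $N(v,w)=N(v)\cup N(w)$. The private neighborhood of a pair of blue vertices $v,w$ is $P(v,w)=\{r\in N(v,w): N(N(r))\subseteq N(v,w)\}$. A red-blue dominating set of $G$ is a set $D\subseteq V_B$ such that every red vertex is adjacent to a vertex of $D$. -}

module Defs where

open import Data.Nat using (ℕ; suc)
open import Data.Fin using (Fin; zero; suc; _≟_)
open import Data.Fin.Subset using (Subset; _∈_; ∣_∣)
open import Data.Bool using (Bool; T; _∨_)
open import Data.Integer using (ℤ; +_; _≤_; _-_)
open import Data.Product using (Σ; ∃; ∃-syntax; _×_)
open import Data.Sum using (_⊎_)
open import Data.Unit using (⊤)
open import Relation.Nullary using (¬_; does)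
open import Relation.Binary.PropositionalEquality using (_≡_; _≢_)

-- A finite bipartite graph: blue vertices Fin nB, red vertices Fin nR,
-- edges given by a Boolean adjacency between blue and red vertices.
Adj : ℕ → ℕ → Set
Adj nB nR = Fin nB → Fin nR → Bool

module _ {nB nR : ℕ} (adj : Adj nB nR) where

  Edge : Fin nB → Fin nR → Set
  Edge b r = T (adj b r)

  Nvw : Fin nB → Fin nB → Fin nR → Set
  Nvw v w r = Edge v r ⊎ Edge w r

  NN : Fin nR → Fin nR → Set
  NN r r' = ∃[ b ] (Edge b r × Edge b r')

  Priv : Fin nB → Fin nB → Fin nR → Set
  Priv v w r = Nvw v w r × (∀ r' → NN r r' → Nvw v w r')

  BlueReduced : Set
  BlueReduced = ∀ b b' → b ≢ b' → ¬ (∀ r → Edge b r → Edge b' r)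

  RedReduced : Set
  RedReduced = ∀ r r' → r ≢ r' → ¬ (∀ b → Edge b r' → Edge b r)

  -- Red-blue dominating set of size at most k in the subgraph induced on
  -- the blue vertices satisfying InB and the red vertices satisfying InR.
  HasRBDS : (InB : Fin nB → Set) (InR : Fin nR → Set) → ℤ → Set
  HasRBDS InB InR k =
    Σ (Subset nB) λ D →
      (∀ b → b ∈ D → InB b) ×
      (∀ r → InR r → ∃[ b ] (b ∈ D × Edge b r)) ×
      (+ ∣ D ∣ ≤ k)

  AllB : Fin nB → Set
  AllB _ = ⊤
  AllR : Fin nR → Set
  AllR _ = ⊤

-- Case (2): the graph with a new red vertex (index zero) adjacent exactly to v and w;
-- old red vertex r has index suc r.
addRed : {nB nR : ℕ} → Adj nB nR → Fin nB → Fin nB → Adj nB (suc nR)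
addRed adj v w b zero = does (b ≟ v) ∨ does (b ≟ w)
addRed adj v w b (suc r) = adj b r

keepR2 : {nB nR : ℕ} → Adj nB nR → Fin nB → Fin nB → Fin (suc nR) → Set
keepR2 adj v w zero = ⊤
keepR2 adj v w (suc r) = ¬ Priv adj v w r

-- Call a blue vertex b confined if N(b) ⊆ N(v,w). Every blue neighbour of a private
-- vertex r is confined, since N(b) ⊆ N(N(r)) ⊆ N(v,w). Let D be a dominating set in
-- which no vertex dominates all of P(v,w). The vertex b₁ ∈ D dominating some private
-- vertex misses another private vertex, whose dominator b₂ ∈ D is a second confined
-- vertex. Discarding all confined vertices from D therefore saves at least two, while
-- every red vertex outside N(v,w) stays dominated; adding v and/or w back (as each case
-- requires) gives the reduced solution. Conversely a reduced solution extended by v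
-- and/or w dominates G.
module Submission where

open import Defs
open import Data.Nat as ℕ using (ℕ; suc; z≤n; s≤s)
import Data.Nat.Properties as ℕ
open import Data.Fin using (Fin; zero; suc; _≟_)
open import Data.Fin.Properties using (all?; any?)
open import Data.Fin.Subset
  using (Subset; _∈_; _∉_; ∣_∣; ⁅_⁆; _∪_; _─_; inside; outside)
open import Data.Fin.Subset.Properties
  using ( _∈?_; x∈⁅x⁆; x∈⁅y⁆⇒x≡y; x∉⁅y⁆⇒x≢y; ∣⁅x⁆∣≡1; x∈p∪q⁺; x∈p∪q⁻; x∈p∩q⁺
        ; p─q⊆p; p⊆q⇒∣p∣≤∣q∣; x∈p∧x∉q⇒x∈p─q; x∈p∧x≢y⇒x∈p-y; x∈p⇒∣p-x∣<∣p∣; p∩q≢∅⇒∣p─q∣<∣p∣)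
open import Data.Vec.Base using ([]; _∷_; here; there; tabulate)
open import Data.Vec.Properties using (lookup∘tabulate; lookup⇒[]=; []=⇒lookup)
open import Data.Bool using (T)
open import Data.Bool.Properties using (T-∨)
open import Data.Integer as ℤ using (ℤ; +_; _-_; +≤+)
import Data.Integer.Properties as ℤ
open import Data.Integer.Tactic.RingSolver using (solve-∀)
open import Data.Product using (∃-syntax; _×_; _,_)
open import Data.Sum using (_⊎_; inj₁; inj₂; [_,_]′)
import Data.Sum as Sum
open import Data.Unit using (tt)
open import Data.Empty using (⊥-elim)
open import Function using (_∘_; id)
open import Function.Bundles using (_⇔_; mk⇔; Equivalence)
open import Relation.Nullary using (¬_; Dec; yes; no; does; contradiction)
open import Relation.Nullary.Decidable
  using (toSum; dec-true; decidable-stable; T?; ¬?; _×-dec_; _⊎-dec_; _→-dec_)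
open import Relation.Binary.PropositionalEquality
  using (_≡_; _≢_; refl; sym; trans; cong; ≢-sym)

private
  variable
    n : ℕ

x∈p─q⇒x∉q : {x : Fin n} {p : Subset n} (q : Subset n) → x ∈ p ─ q → x ∉ q
x∈p─q⇒x∉q {p = inside ∷ p} (outside ∷ q) here        = λ ()
x∈p─q⇒x∉q {p = s ∷ p}      (outside ∷ q) (there x∈) = λ { (there x∈q) → x∈p─q⇒x∉q q x∈ x∈q }
x∈p─q⇒x∉q {p = s ∷ p}      (inside ∷ q)  (there x∈) = λ { (there x∈q) → x∈p─q⇒x∉q q x∈ x∈q }

∣p∪q∣≤∣p∣+∣q∣ : (p q : Subset n) → ∣ p ∪ q ∣ ℕ.≤ ∣ p ∣ ℕ.+ ∣ q ∣
∣p∪q∣≤∣p∣+∣q∣ [] [] = z≤n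
∣p∪q∣≤∣p∣+∣q∣ (outside ∷ p) (outside ∷ q) = ∣p∪q∣≤∣p∣+∣q∣ p q
∣p∪q∣≤∣p∣+∣q∣ (outside ∷ p) (inside ∷ q)  =
  ℕ.≤-trans (s≤s (∣p∪q∣≤∣p∣+∣q∣ p q)) (ℕ.≤-reflexive (sym (ℕ.+-suc ∣ p ∣ ∣ q ∣)))
∣p∪q∣≤∣p∣+∣q∣ (inside ∷ p)  (outside ∷ q) = s≤s (∣p∪q∣≤∣p∣+∣q∣ p q)
∣p∪q∣≤∣p∣+∣q∣ (inside ∷ p)  (inside ∷ q)  =
  s≤s (ℕ.≤-trans (∣p∪q∣≤∣p∣+∣q∣ p q) (ℕ.+-monoʳ-≤ ∣ p ∣ (ℕ.n≤1+n ∣ q ∣)))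

∣⁅x⁆∪p∣≤1+∣p∣ : (x : Fin n) (p : Subset n) → ∣ ⁅ x ⁆ ∪ p ∣ ℕ.≤ suc ∣ p ∣
∣⁅x⁆∪p∣≤1+∣p∣ x p =
  ℕ.≤-trans (∣p∪q∣≤∣p∣+∣q∣ ⁅ x ⁆ p) (ℕ.≤-reflexive (cong (ℕ._+ ∣ p ∣) (∣⁅x⁆∣≡1 x)))

x,y∈p∩q⇒2+∣p─q∣≤∣p∣ : {x y : Fin n} {p : Subset n} (q : Subset n) → x ≢ y →
                      x ∈ p → y ∈ p → x ∈ q → y ∈ q → 2 ℕ.+ ∣ p ─ q ∣ ℕ.≤ ∣ p ∣
x,y∈p∩q⇒2+∣p─q∣≤∣p∣ {x = x} {y} {p} q x≢y x∈p y∈p x∈q y∈q = begin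
  2 ℕ.+ ∣ p ─ q ∣            ≤⟨ s≤s (s≤s (p⊆q⇒∣p∣≤∣q∣ p─q⊆p-x─q)) ⟩
  2 ℕ.+ ∣ (p ─ ⁅ x ⁆) ─ q ∣  ≤⟨ s≤s (p∩q≢∅⇒∣p─q∣<∣p∣ (p ─ ⁅ x ⁆) q (y , x∈p∩q⁺ (y∈p-x , y∈q))) ⟩
  suc ∣ p ─ ⁅ x ⁆ ∣          ≤⟨ x∈p⇒∣p-x∣<∣p∣ x∈p ⟩
  ∣ p ∣                      ∎
  where
  open ℕ.≤-Reasoning
  y∈p-x : y ∈ p ─ ⁅ x ⁆
  y∈p-x = x∈p∧x≢y⇒x∈p-y y∈p (≢-sym x≢y)
  p─q⊆p-x─q : ∀ {z} → z ∈ p ─ q → z ∈ (p ─ ⁅ x ⁆) ─ q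
  p─q⊆p-x─q z∈ = x∈p∧x∉q⇒x∈p─q
    (x∈p∧x≢y⇒x∈p-y (p─q⊆p p q z∈) (λ { refl → x∈p─q⇒x∉q q z∈ x∈q }))
    (x∈p─q⇒x∉q q z∈)

satisfying : {P : Fin n → Set} → (∀ x → Dec (P x)) → Subset n
satisfying P? = tabulate (does ∘ P?)

module _ {P : Fin n → Set} (P? : ∀ x → Dec (P x)) where

  ∈satisfying⁺ : {x : Fin n} → P x → x ∈ satisfying P?
  ∈satisfying⁺ {x} px =
    lookup⇒[]= x _ (trans (lookup∘tabulate (does ∘ P?) x) (dec-true (P? x) px))

  ∈satisfying⁻ : {x : Fin n} → x ∈ satisfying P? → P x
  ∈satisfying⁻ {x} x∈ with P? x | trans (sym (lookup∘tabulate (does ∘ P?) x)) ([]=⇒lookup x∈)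
  ... | yes px | _ = px
  ... | no _   | ()

budget-shrink : {m a c : ℕ} {k : ℤ} → m ℕ.+ a ℕ.≤ c → + c ℤ.≤ k → + a ℤ.≤ k - + m
budget-shrink {m} {a} {c} {k} m+a≤c c≤k = begin
  + a                ≡⟨ sym ([i+j]-i≡j (+ m) (+ a)) ⟩
  + m ℤ.+ + a - + m  ≡⟨ cong (_- + m) (ℤ.pos-+ m a) ⟨
  + (m ℕ.+ a) - + m  ≤⟨ ℤ.+-monoˡ-≤ (ℤ.- + m) (ℤ.≤-trans (+≤+ m+a≤c) c≤k) ⟩
  k - + m            ∎
  where
  open ℤ.≤-Reasoning
  [i+j]-i≡j : ∀ i j → i ℤ.+ j - i ≡ j
  [i+j]-i≡j = solve-∀

budget-grow : {m a c : ℕ} {k : ℤ} → c ℕ.≤ m ℕ.+ a → + a ℤ.≤ k - + m → + c ℤ.≤ k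
budget-grow {m} {a} {c} {k} c≤m+a a≤k-m = begin
  + c                ≤⟨ +≤+ c≤m+a ⟩
  + (m ℕ.+ a)        ≡⟨ ℤ.pos-+ m a ⟩
  + m ℤ.+ + a        ≤⟨ ℤ.+-monoʳ-≤ (+ m) a≤k-m ⟩
  + m ℤ.+ (k - + m)  ≡⟨ i+[j-i]≡j (+ m) k ⟩
  k                  ∎
  where
  open ℤ.≤-Reasoning
  i+[j-i]≡j : ∀ i j → i ℤ.+ (j - i) ≡ j
  i+[j-i]≡j = solve-∀

T-does : {A : Set} (a? : Dec A) → T (does a?) ⇔ A
T-does (yes a) = mk⇔ (λ _ → a) (λ _ → tt)
T-does (no ¬a) = mk⇔ (λ ()) ¬a

module _ {nB nR : ℕ} (adj : Adj nB nR) where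

  Dominates : Subset nB → (Fin nR → Set) → Set
  Dominates D InR = ∀ r → InR r → ∃[ b ] (b ∈ D × Edge adj b r)

  Edge? : ∀ b r → Dec (Edge adj b r)
  Edge? b r = T? (adj b r)

  ⁅x⁆∪-dominates : {D : Subset nB} {InR InR′ : Fin nR → Set} (x : Fin nB) →
                   Dominates D InR → (∀ r → InR′ r → Edge adj x r ⊎ InR r) →
                   Dominates (⁅ x ⁆ ∪ D) InR′
  ⁅x⁆∪-dominates x dom split r r∈ with split r r∈
  ... | inj₁ e  = x , x∈p∪q⁺ (inj₁ (x∈⁅x⁆ x)) , e
  ... | inj₂ r∈′ with dom r r∈′
  ...   | b , b∈ , e = b , x∈p∪q⁺ (inj₂ b∈) , e

module PrivatePair {nB nR : ℕ} (adj : Adj nB nR) (v w : Fin nB) where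

  Confined : Fin nB → Set
  Confined b = ∀ r → Edge adj b r → Nvw adj v w r

  Covers : Fin nB → Set
  Covers b = ∀ r → Priv adj v w r → Edge adj b r

  confined-v : Confined v
  confined-v _ = inj₁

  confined-w : Confined w
  confined-w _ = inj₂

  Priv⇒confined : ∀ {r b} → Priv adj v w r → Edge adj b r → Confined b
  Priv⇒confined (_ , N[N[r]]⊆N[v,w]) e r′ e′ = N[N[r]]⊆N[v,w] r′ (_ , e , e′)

  Nvw? : ∀ r → Dec (Nvw adj v w r)
  Nvw? r = Edge? adj v r ⊎-dec Edge? adj w r

  Confined? : ∀ b → Dec (Confined b)
  Confined? b = all? λ r → Edge? adj b r →-dec Nvw? r

  Priv? : ∀ r → Dec (Priv adj v w r)
  Priv? r = Nvw? r ×-dec all? λ r′ → any? (λ b → Edge? adj b r ×-dec Edge? adj b r′) →-dec Nvw? r′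

  uncovered-private : ∀ {b} → ¬ Covers b → ∃[ r ] (Priv adj v w r × ¬ Edge adj b r)
  uncovered-private {b} ¬covers with any? (λ r → Priv? r ×-dec ¬? (Edge? adj b r))
  ... | yes found = found
  ... | no none   =
    ⊥-elim (¬covers λ r priv → decidable-stable (Edge? adj b r) λ ¬e → none (r , priv , ¬e))

  core : Subset nB → Subset nB
  core D = D ─ satisfying Confined?

  core-unconfined : ∀ {D b} → b ∈ core D → ¬ Confined b
  core-unconfined b∈ = x∈p─q⇒x∉q (satisfying Confined?) b∈ ∘ ∈satisfying⁺ Confined?

  core-≢v : ∀ {D b} → b ∈ core D → b ≢ v
  core-≢v b∈ refl = core-unconfined b∈ confined-v

  core-≢w : ∀ {D b} → b ∈ core D → b ≢ w
  core-≢w b∈ refl = core-unconfined b∈ confined-w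

  core-dominates : ∀ {D} → Dominates adj D (AllR adj) →
                   Dominates adj (core D) (¬_ ∘ Nvw adj v w)
  core-dominates dom r r∉N[v,w] with dom r tt
  ... | b , b∈D , e =
    b , x∈p∧x∉q⇒x∈p─q b∈D (λ b∈C → r∉N[v,w] (∈satisfying⁻ Confined? b∈C r e)) , e

  uncovered⇒core-shrinks-by-two : ∀ {D r₁} → Priv adj v w r₁ → Dominates adj D (AllR adj) →
                 (∀ b → b ∈ D → ¬ Covers b) → 2 ℕ.+ ∣ core D ∣ ℕ.≤ ∣ D ∣
  uncovered⇒core-shrinks-by-two {r₁ = r₁} r₁-private dom no-cover with dom r₁ tt
  ... | b₁ , b₁∈D , e₁ with uncovered-private (no-cover b₁ b₁∈D)
  ... | r , r-private , ¬e₁ with dom r tt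
  ... | b₂ , b₂∈D , e₂ =
    x,y∈p∩q⇒2+∣p─q∣≤∣p∣ (satisfying Confined?) b₁≢b₂ b₁∈D b₂∈D
      (∈satisfying⁺ Confined? (Priv⇒confined r₁-private e₁))
      (∈satisfying⁺ Confined? (Priv⇒confined r-private e₂))
    where
    b₁≢b₂ : b₁ ≢ b₂
    b₁≢b₂ refl = ¬e₁ e₂

  insertPair : Subset nB → Subset nB
  insertPair D = ⁅ v ⁆ ∪ (⁅ w ⁆ ∪ D)

  v∈insertPair : ∀ D → v ∈ insertPair D
  v∈insertPair D = x∈p∪q⁺ (inj₁ (x∈⁅x⁆ v))

  ∣insertPair∣≤2+ : ∀ D → ∣ insertPair D ∣ ℕ.≤ 2 ℕ.+ ∣ D ∣
  ∣insertPair∣≤2+ D = ℕ.≤-trans (∣⁅x⁆∪p∣≤1+∣p∣ v _) (s≤s (∣⁅x⁆∪p∣≤1+∣p∣ w D))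

  ¬Edge-v⇒Edge-w⊎¬Nvw : ∀ r → ¬ Edge adj v r → Edge adj w r ⊎ ¬ Nvw adj v w r
  ¬Edge-v⇒Edge-w⊎¬Nvw r ¬e-v with Edge? adj w r
  ... | yes e-w  = inj₁ e-w
  ... | no ¬e-w = inj₂ [ ¬e-v , ¬e-w ]′

  insertPair-dominates : ∀ {D} → Dominates adj D (¬_ ∘ Nvw adj v w) →
                         Dominates adj (insertPair D) (AllR adj)
  insertPair-dominates dom =
    ⁅x⁆∪-dominates adj v (⁅x⁆∪-dominates adj w dom ¬Edge-v⇒Edge-w⊎¬Nvw) λ r _ → toSum (Edge? adj v r)

  addRed-neighbour : ∀ b → Edge (addRed adj v w) b zero → b ≡ v ⊎ b ≡ w
  addRed-neighbour b =
    Sum.map (Equivalence.to (T-does (b ≟ v))) (Equivalence.to (T-does (b ≟ w))) ∘ Equivalence.to T-∨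

  addRed-dominates : ∀ {D} → Dominates adj D (AllR adj) → v ∈ D ⊎ w ∈ D →
                     Dominates (addRed adj v w) D (keepR2 adj v w)
  addRed-dominates _ (inj₁ v∈D) zero _ =
    v , v∈D , Equivalence.from T-∨ (inj₁ (Equivalence.from (T-does (v ≟ v)) refl))
  addRed-dominates _ (inj₂ w∈D) zero _ =
    w , w∈D , Equivalence.from T-∨ (inj₂ (Equivalence.from (T-does (w ≟ w)) refl))
  addRed-dominates dom _ (suc r) _ = dom r tt

  module Reduction (k : ℤ) {r₁ : Fin nR} (r₁-private : Priv adj v w r₁)
                   (only-v-w-cover : ∀ d → d ≢ v → d ≢ w → ¬ Covers d) where

    core-shrinks-by-two : ∀ {D} → Dominates adj D (AllR adj) →
                          v ∉ D ⊎ ¬ Covers v → w ∉ D ⊎ ¬ Covers w → 2 ℕ.+ ∣ core D ∣ ℕ.≤ ∣ D ∣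
    core-shrinks-by-two {D} dom v-ok w-ok = uncovered⇒core-shrinks-by-two r₁-private dom no-cover
      where
      no-cover : ∀ b → b ∈ D → ¬ Covers b
      no-cover b b∈D with b ≟ v | b ≟ w
      ... | yes refl | _        = [ contradiction b∈D , id ]′ v-ok
      ... | no _     | yes refl = [ contradiction b∈D , id ]′ w-ok
      ... | no b≢v   | no b≢w   = only-v-w-cover b b≢v b≢w

    reduce-neither-covers : ¬ Covers v → ¬ Covers w →
      HasRBDS adj (AllB adj) (AllR adj) k ⇔
      HasRBDS adj (λ b → b ≢ v × b ≢ w) (λ r → ¬ Nvw adj v w r) (k - + 2)
    reduce-neither-covers ¬cov-v ¬cov-w = mk⇔
      (λ (D , _ , dom , ∣D∣≤k) →
        core D , (λ _ b∈ → core-≢v b∈ , core-≢w b∈) , core-dominates dom ,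
        budget-shrink (core-shrinks-by-two dom (inj₂ ¬cov-v) (inj₂ ¬cov-w)) ∣D∣≤k)
      (λ (D , _ , dom , ∣D∣≤k) →
        insertPair D , (λ _ _ → tt) , insertPair-dominates dom ,
        budget-grow (∣insertPair∣≤2+ D) ∣D∣≤k)

    reduce-both-cover : Covers v → Covers w →
      HasRBDS adj (AllB adj) (AllR adj) k ⇔
      HasRBDS (addRed adj v w) (AllB (addRed adj v w)) (keepR2 adj v w) k
    reduce-both-cover cov-v cov-w = mk⇔ to from
      where
      to : HasRBDS adj (AllB adj) (AllR adj) k →
           HasRBDS (addRed adj v w) (AllB (addRed adj v w)) (keepR2 adj v w) k
      to (D , _ , dom , ∣D∣≤k) with v ∈? D | w ∈? D
      ... | yes v∈D | _       = D , (λ _ _ → tt) , addRed-dominates dom (inj₁ v∈D) , ∣D∣≤k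
      ... | no _    | yes w∈D = D , (λ _ _ → tt) , addRed-dominates dom (inj₂ w∈D) , ∣D∣≤k
      ... | no v∉D  | no w∉D  =
        insertPair (core D) , (λ _ _ → tt) ,
        addRed-dominates (insertPair-dominates (core-dominates dom)) (inj₁ (v∈insertPair _)) ,
        ℤ.≤-trans (+≤+ (ℕ.≤-trans (∣insertPair∣≤2+ _)
                                  (core-shrinks-by-two dom (inj₁ v∉D) (inj₁ w∉D)))) ∣D∣≤k

      from : HasRBDS (addRed adj v w) (AllB (addRed adj v w)) (keepR2 adj v w) k →
             HasRBDS adj (AllB adj) (AllR adj) k
      from (D , _ , dom , ∣D∣≤k) = D , (λ _ _ → tt) , dom′ , ∣D∣≤k
        where
        dom′ : Dominates adj D (AllR adj)
        dom′ r _ with Priv? r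
        ... | no ¬priv = dom (suc r) ¬priv
        ... | yes priv with dom zero tt
        ...   | b , b∈D , e =
          b , b∈D , [ (λ { refl → cov-v r priv }) , (λ { refl → cov-w r priv }) ]′ (addRed-neighbour b e)

    reduce-by-v : v ≢ w → ¬ Covers w →
      HasRBDS adj (AllB adj) (AllR adj) k ⇔
      HasRBDS adj (λ b → b ≢ v) (λ r → ¬ Edge adj v r) (k - + 1)
    reduce-by-v v≢w ¬cov-w = mk⇔ to from
      where
      to : HasRBDS adj (AllB adj) (AllR adj) k →
           HasRBDS adj (λ b → b ≢ v) (λ r → ¬ Edge adj v r) (k - + 1)
      to (D , _ , dom , ∣D∣≤k) with v ∈? D
      ... | yes v∈D =
        D ─ ⁅ v ⁆ , (λ _ b∈ → x∉⁅y⁆⇒x≢y (x∈p─q⇒x∉q ⁅ v ⁆ b∈)) , dom′ ,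
        budget-shrink (x∈p⇒∣p-x∣<∣p∣ v∈D) ∣D∣≤k
        where
        dom′ : Dominates adj (D ─ ⁅ v ⁆) (λ r → ¬ Edge adj v r)
        dom′ r ¬e-v with dom r tt
        ... | b , b∈D , e = b , x∈p∧x≢y⇒x∈p-y b∈D (λ { refl → ¬e-v e }) , e
      ... | no v∉D =
        ⁅ w ⁆ ∪ core D , ≢v , ⁅x⁆∪-dominates adj w (core-dominates dom) ¬Edge-v⇒Edge-w⊎¬Nvw ,
        budget-shrink (ℕ.≤-trans (s≤s (∣⁅x⁆∪p∣≤1+∣p∣ w _))
                                 (core-shrinks-by-two dom (inj₁ v∉D) (inj₂ ¬cov-w))) ∣D∣≤k
        where
        ≢v : ∀ b → b ∈ ⁅ w ⁆ ∪ core D → b ≢ v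
        ≢v b b∈ with x∈p∪q⁻ ⁅ w ⁆ (core D) b∈
        ... | inj₁ b∈⁅w⁆ rewrite x∈⁅y⁆⇒x≡y w b∈⁅w⁆ = ≢-sym v≢w
        ... | inj₂ b∈core = core-≢v b∈core

      from : HasRBDS adj (λ b → b ≢ v) (λ r → ¬ Edge adj v r) (k - + 1) →
             HasRBDS adj (AllB adj) (AllR adj) k
      from (D , _ , dom , ∣D∣≤k) =
        ⁅ v ⁆ ∪ D , (λ _ _ → tt) , ⁅x⁆∪-dominates adj v dom (λ r _ → toSum (Edge? adj v r)) ,
        budget-grow (∣⁅x⁆∪p∣≤1+∣p∣ v D) ∣D∣≤k

Priv-swap : ∀ {nB nR} (adj : Adj nB nR) {v w r} → Priv adj v w r → Priv adj w v r
Priv-swap adj (r∈N[v,w] , N[N[r]]⊆N[v,w]) = Sum.swap r∈N[v,w] , λ r′ → Sum.swap ∘ N[N[r]]⊆N[v,w] r′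

Covers-swap : ∀ {nB nR} (adj : Adj nB nR) {v w b} →
              PrivatePair.Covers adj w v b → PrivatePair.Covers adj v w b
Covers-swap adj cov r = cov r ∘ Priv-swap adj

lemma3 : {nB nR : ℕ} (adj : Adj nB nR) (k : ℤ) (v w : Fin nB) →
    BlueReduced adj → RedReduced adj → v ≢ w →
    (∃[ r₁ ] ∃[ r₂ ] (r₁ ≢ r₂ × Priv adj v w r₁ × Priv adj v w r₂)) →
    (∀ d → d ≢ v → d ≢ w → ¬ (∀ r → Priv adj v w r → Edge adj d r)) →
    ((¬ (∀ r → Priv adj v w r → Edge adj v r)) → (¬ (∀ r → Priv adj v w r → Edge adj w r)) →
      (HasRBDS adj (AllB adj) (AllR adj) k ⇔
       HasRBDS adj (λ b → b ≢ v × b ≢ w) (λ r → ¬ Nvw adj v w r) (k - + 2))) ×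
    ((∀ r → Priv adj v w r → Edge adj v r) → (∀ r → Priv adj v w r → Edge adj w r) →
      (HasRBDS adj (AllB adj) (AllR adj) k ⇔
       HasRBDS (addRed adj v w) (AllB (addRed adj v w)) (keepR2 adj v w) k)) ×
    ((∀ r → Priv adj v w r → Edge adj v r) → (¬ (∀ r → Priv adj v w r → Edge adj w r)) →
      (HasRBDS adj (AllB adj) (AllR adj) k ⇔
       HasRBDS adj (λ b → b ≢ v) (λ r → ¬ Edge adj v r) (k - + 1))) ×
    ((¬ (∀ r → Priv adj v w r → Edge adj v r)) → (∀ r → Priv adj v w r → Edge adj w r) →
      (HasRBDS adj (AllB adj) (AllR adj) k ⇔
       HasRBDS adj (λ b → b ≢ w) (λ r → ¬ Edge adj w r) (k - + 1)))
lemma3 adj k v w _ _ v≢w (_ , _ , _ , r₁-private , _) only-v-w-cover =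
  reduce-neither-covers ,
  reduce-both-cover ,
  (λ _ → reduce-by-v v≢w) ,
  (λ ¬cov-v _ → Swapped.reduce-by-v (≢-sym v≢w) (¬cov-v ∘ Covers-swap adj))
  where
  open PrivatePair.Reduction adj v w k r₁-private only-v-w-cover
  module Swapped = PrivatePair.Reduction adj w v k (Priv-swap adj r₁-private)
    (λ d d≢w d≢v → only-v-w-cover d d≢v d≢w ∘ Covers-swap adj)
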